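{- Let $m$ and $n$ be non-negative integers and $r$ any integer. Then \[ \sum_{k=1}^nk^mF_{k + r} = P_1 (m,n)F_{n + r} + P_2 (m,n)F_{n + r + 1} + C(m,r),\qquad \sum_{k=1}^nk^mL_{k + r}= P_1 (m,n)L_{n + r} + P_2 (m,n)L_{n + r + 1} + K(m,r), \] where $P_1, P_2$ are defined recursively by \[ P_1 (m,n) = (n + 2)^m - \sum_{j = 0}^{m - 1} \binom mj(2^{m - j} + 1)P_1 (j,n),\qquad P_2 (m,n) = (n + 1)^m - \sum_{j = 0}^{m - 1} \binom mj(2^{m - j} + 1)P_2 (j,n), \] and $C(m,r)$, $K(m,r)$ are defined recursively (in $m$) by \[ C(m,r) = - 2^m F_r - F_{r + 1} - \sum_{j = 0}^{m - 1} \binom mj(2^{m - j} + 1)C(j,r),\qquad K(m,r) = - 2^m L_r - L_{r + 1} - \sum_{j = 0}^{m - 1} \binom mj(2^{m - j} + 1)K(j,r). \]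
   Context: $F_j$ and $L_j$ are the Fibonacci and Lucas numbers defined for all integers $j$ by $F_0=0$, $F_1=1$, $L_0=2$, $L_1=1$, $X_j=X_{j-1}+X_{j-2}$ (equivalently $F_{ -j}=(-1)^{j-1}F_j$, $L_{ -j}=(-1)^jL_j$). Empty sums are $0$ and $0^0=1$. -}

module Defs where

open import Data.Nat as ℕ using (ℕ; zero; suc)
open import Data.Nat.Combinatorics using (_C_)
open import Data.Integer as ℤ using (ℤ; +_; -[1+_]; _+_; _-_; _*_; -_; _^_)
open import Data.List using (List; []; _∷_; _∷ʳ_; length; lookup; upTo; map; sum; zip)
open import Data.Product using (_,_)

fibℕ : ℕ → ℤ
fibℕ zero = + 0
fibℕ (suc zero) = + 1
fibℕ (suc (suc n)) = fibℕ (suc n) + fibℕ n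

lucℕ : ℕ → ℤ
lucℕ zero = + 2
lucℕ (suc zero) = + 1
lucℕ (suc (suc n)) = lucℕ (suc n) + lucℕ n

sgn : ℕ → ℤ
sgn j = (- + 1) ^ j

-- F_j and L_j for all integers j, via F_{-j} = (-1)^{j-1} F_j, L_{-j} = (-1)^j L_j
F : ℤ → ℤ
F (+ n) = fibℕ n
F -[1+ n ] = sgn n * fibℕ (suc n)

L : ℤ → ℤ
L (+ n) = lucℕ n
L -[1+ n ] = sgn (suc n) * lucℕ (suc n)

Σ< : ℕ → (ℕ → ℤ) → ℤ
Σ< zero f = + 0
Σ< (suc m) f = Σ< m f + f m

Σ1 : ℕ → (ℕ → ℤ) → ℤ
Σ1 zero f = + 0
Σ1 (suc n) f = Σ1 n f + f (suc n)

coef : ℕ → ℕ → ℤ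
coef m j = + (m C j) * + (2 ℕ.^ (m ℕ.∸ j) ℕ.+ 1)

-- Generic recursion  X(m) = base(m) - Σ_{j=0}^{m-1} binom(m,j)(2^{m-j}+1) X(j).
-- prefix m = [X 0, ..., X (m-1)] (course-of-values).
lookupD : List ℤ → ℕ → ℤ
lookupD [] _ = + 0
lookupD (x ∷ xs) zero = x
lookupD (x ∷ xs) (suc j) = lookupD xs j

step : (ℕ → ℤ) → ℕ → List ℤ → ℤ
step base m xs = base m - Σ< m (λ j → coef m j * lookupD xs j)

prefix : (ℕ → ℤ) → ℕ → List ℤ
prefix base zero = []
prefix base (suc m) = prefix base m ∷ʳ step base m (prefix base m)

recX : (ℕ → ℤ) → ℕ → ℤ
recX base m = step base m (prefix base m)

P₁ : ℕ → ℕ → ℤ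
P₁ m n = recX (λ i → + ((n ℕ.+ 2) ℕ.^ i)) m

P₂ : ℕ → ℕ → ℤ
P₂ m n = recX (λ i → + ((n ℕ.+ 1) ℕ.^ i)) m

Cc : ℕ → ℤ → ℤ
Cc m r = recX (λ i → - (+ (2 ℕ.^ i) * F r) - F (r + + 1)) m

Kc : ℕ → ℤ → ℤ
Kc m r = recX (λ i → - (+ (2 ℕ.^ i) * L r) - L (r + + 1)) m

{-# OPTIONS --safe #-}
-- Each of P₁, P₂, C, K is the solution X of coefSum X = b for its base sequence b, where
-- coefSum X m = X m + Σ_{j<m} binom(m,j) (2^{m-j} + 1) X j is linear and unitriangular, so an identity
-- between such solutions only has to be checked on the bases. Two binomial expansions give
-- coefSum (x^·) = (x+2)^· + (x+1)^· − x^·, whence (n+1)^m = P₁(m,n+1) + P₁(m,n) − P₂(m,n); together with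
-- P₂(m,n+1) = P₁(m,n) and G_{k+2} = G_{k+1} + G_k this is the induction step in n, and the case n = 0
-- is C(m,r) = −P₁(m,0) G_r − P₂(m,0) G_{r+1}, again an identity of bases.
module Submission where

open import Defs
open import Data.Nat using (ℕ; _^_)
open import Data.Integer using (ℤ; +_; _+_; _*_)
open import Data.Product using (_×_; _,_)
open import Relation.Binary.PropositionalEquality using (_≡_; refl; sym; trans; cong; cong₂; subst; module ≡-Reasoning)

open import Data.Nat as ℕ using (zero; suc; s≤s)
import Data.Nat.Properties as ℕP
open import Data.Nat.Combinatorics using (_C_; nCn≡1)
open import Data.Nat.Induction using (<-rec)
open import Data.Integer as ℤ using (-[1+_]; _-_; -_)
import Data.Integer.Properties as ℤP
open import Data.Integer.Tactic.RingSolver using (solve-∀)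
open import Data.Fin using (toℕ)
import Algebra.Properties.CommutativeSemiring.Binomial as Binomial
import Algebra.Properties.Monoid.Sum as MonoidSum
import Algebra.Properties.Semiring.Mult as SemiringMult
import Algebra.Properties.Semiring.Exp as SemiringExp
open import Data.List using ([]; _∷_; _∷ʳ_; length)
open import Data.List.Properties using (length-++)
open import Data.Sum using (inj₁; inj₂)
open ≡-Reasoning

module ℤ-Binomial = Binomial ℤP.+-*-commutativeSemiring
module ℤ-Sum = MonoidSum ℤP.+-0-monoid
module ℤ-Mult = SemiringMult ℤP.+-*-semiring
module ℤ-Exp = SemiringExp ℤP.+-*-semiring

Σ<-cong : ∀ m {f g : ℕ → ℤ} → (∀ {j} → j ℕ.< m → f j ≡ g j) → Σ< m f ≡ Σ< m g
Σ<-cong zero    f≡g = refl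
Σ<-cong (suc m) f≡g = cong₂ _+_ (Σ<-cong m (λ j<m → f≡g (ℕP.m<n⇒m<1+n j<m))) (f≡g (ℕP.n<1+n m))

Σ<-+ : ∀ m (f g : ℕ → ℤ) → Σ< m (λ j → f j + g j) ≡ Σ< m f + Σ< m g
Σ<-+ zero    f g = refl
Σ<-+ (suc m) f g = trans (cong (_+ (f m + g m)) (Σ<-+ m f g)) (interchange (Σ< m f) (Σ< m g) (f m) (g m))
  where
  interchange : ∀ a b c d → (a + b) + (c + d) ≡ (a + c) + (b + d)
  interchange = solve-∀

Σ<-neg : ∀ m (f : ℕ → ℤ) → Σ< m (λ j → - f j) ≡ - Σ< m f
Σ<-neg zero    f = refl
Σ<-neg (suc m) f = trans (cong (_- f m) (Σ<-neg m f)) (sym (ℤP.neg-distrib-+ (Σ< m f) (f m)))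

Σ<-*ʳ : ∀ m (f : ℕ → ℤ) a → Σ< m (λ j → f j * a) ≡ Σ< m f * a
Σ<-*ʳ zero    f a = ℤP.*-zeroˡ a
Σ<-*ʳ (suc m) f a = trans (cong (_+ f m * a) (Σ<-*ʳ m f a)) (sym (ℤP.*-distribʳ-+ a (Σ< m f) (f m)))

Σ<-suc : ∀ m (f : ℕ → ℤ) → Σ< (suc m) f ≡ f 0 + Σ< m (λ j → f (suc j))
Σ<-suc zero    f = ℤP.+-comm (+ 0) (f 0)
Σ<-suc (suc m) f = trans (cong (_+ f (suc m)) (Σ<-suc m f)) (ℤP.+-assoc (f 0) _ _)

coefSum : (ℕ → ℤ) → ℕ → ℤ
coefSum X m = X m + Σ< m (λ j → coef m j * X j)

coefSum-+ : ∀ (X Y : ℕ → ℤ) m → coefSum (λ j → X j + Y j) m ≡ coefSum X m + coefSum Y m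
coefSum-+ X Y m = begin
  X m + Y m + Σ< m (λ j → coef m j * (X j + Y j))
    ≡⟨ cong (_+_ (X m + Y m)) (Σ<-cong m (λ {j} _ → ℤP.*-distribˡ-+ (coef m j) (X j) (Y j))) ⟩
  X m + Y m + Σ< m (λ j → coef m j * X j + coef m j * Y j)
    ≡⟨ cong (_+_ (X m + Y m)) (Σ<-+ m _ _) ⟩
  X m + Y m + (Σ< m (λ j → coef m j * X j) + Σ< m (λ j → coef m j * Y j))
    ≡⟨ interchange (X m) (Y m) _ _ ⟩
  coefSum X m + coefSum Y m ∎
  where
  interchange : ∀ a b c d → (a + b) + (c + d) ≡ (a + c) + (b + d)
  interchange = solve-∀

coefSum-neg : ∀ (X : ℕ → ℤ) m → coefSum (λ j → - X j) m ≡ - coefSum X m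
coefSum-neg X m = begin
  - X m + Σ< m (λ j → coef m j * - X j)
    ≡⟨ cong (_+_ (- X m)) (Σ<-cong m (λ {j} _ → sym (ℤP.neg-distribʳ-* (coef m j) (X j)))) ⟩
  - X m + Σ< m (λ j → - (coef m j * X j))
    ≡⟨ cong (_+_ (- X m)) (Σ<-neg m _) ⟩
  - X m - Σ< m (λ j → coef m j * X j)
    ≡⟨ sym (ℤP.neg-distrib-+ (X m) _) ⟩
  - coefSum X m ∎

coefSum-- : ∀ (X Y : ℕ → ℤ) m → coefSum (λ j → X j - Y j) m ≡ coefSum X m - coefSum Y m
coefSum-- X Y m = trans (coefSum-+ X (λ j → - Y j) m) (cong (_+_ (coefSum X m)) (coefSum-neg Y m))

coefSum-*ʳ : ∀ (X : ℕ → ℤ) a m → coefSum (λ j → X j * a) m ≡ coefSum X m * a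
coefSum-*ʳ X a m = begin
  X m * a + Σ< m (λ j → coef m j * (X j * a))
    ≡⟨ cong (_+_ (X m * a)) (Σ<-cong m (λ {j} _ → sym (ℤP.*-assoc (coef m j) (X j) a))) ⟩
  X m * a + Σ< m (λ j → coef m j * X j * a)
    ≡⟨ cong (_+_ (X m * a)) (Σ<-*ʳ m _ a) ⟩
  X m * a + Σ< m (λ j → coef m j * X j) * a
    ≡⟨ sym (ℤP.*-distribʳ-+ a (X m) _) ⟩
  coefSum X m * a ∎

coefSum-injective : ∀ {X Y : ℕ → ℤ} → (∀ m → coefSum X m ≡ coefSum Y m) → ∀ m → X m ≡ Y m
coefSum-injective {X} {Y} eq = <-rec _ λ m ih → begin
  X m                                         ≡⟨ leading X m ⟩
  coefSum X m - Σ< m (λ j → coef m j * X j)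
    ≡⟨ cong₂ _-_ (eq m) (Σ<-cong m (λ {j} j<m → cong (coef m j *_) (ih j<m))) ⟩
  coefSum Y m - Σ< m (λ j → coef m j * Y j)   ≡⟨ sym (leading Y m) ⟩
  Y m                                         ∎
  where
  cancel : ∀ a s → a ≡ (a + s) - s
  cancel = solve-∀
  leading : ∀ (Z : ℕ → ℤ) m → Z m ≡ coefSum Z m - Σ< m (λ j → coef m j * Z j)
  leading Z m = cancel (Z m) _

lookupD-∷ʳ-< : ∀ xs (y : ℤ) {j} → j ℕ.< length xs → lookupD (xs ∷ʳ y) j ≡ lookupD xs j
lookupD-∷ʳ-< (x ∷ xs) y {zero}  _         = refl
lookupD-∷ʳ-< (x ∷ xs) y {suc j} (s≤s j<n) = lookupD-∷ʳ-< xs y j<n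

lookupD-∷ʳ-length : ∀ xs (y : ℤ) → lookupD (xs ∷ʳ y) (length xs) ≡ y
lookupD-∷ʳ-length []       y = refl
lookupD-∷ʳ-length (x ∷ xs) y = lookupD-∷ʳ-length xs y

length-prefix : ∀ b m → length (prefix b m) ≡ m
length-prefix b zero    = refl
length-prefix b (suc m) = trans (length-++ (prefix b m)) (trans (cong (ℕ._+ 1) (length-prefix b m)) (ℕP.+-comm m 1))

lookupD-prefix : ∀ b m {j} → j ℕ.< m → lookupD (prefix b m) j ≡ recX b j
lookupD-prefix b (suc m) {j} (s≤s j≤m) with ℕP.m≤n⇒m<n∨m≡n j≤m
... | inj₁ j<m = trans (lookupD-∷ʳ-< (prefix b m) _ (subst (j ℕ.<_) (sym (length-prefix b m)) j<m))
                       (lookupD-prefix b m j<m)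
... | inj₂ refl = trans (cong (lookupD (prefix b (suc j))) (sym (length-prefix b j)))
                        (lookupD-∷ʳ-length (prefix b j) _)

coefSum-recX : ∀ b m → coefSum (recX b) m ≡ b m
coefSum-recX b m = begin
  b m - Σ< m (λ j → coef m j * lookupD (prefix b m) j) + Σ< m (λ j → coef m j * recX b j)
    ≡⟨ cong (λ s → b m - s + Σ< m (λ j → coef m j * recX b j))
            (Σ<-cong m (λ {j} j<m → cong (coef m j *_) (lookupD-prefix b m j<m))) ⟩
  b m - Σ< m (λ j → coef m j * recX b j) + Σ< m (λ j → coef m j * recX b j)
    ≡⟨ cancel (b m) _ ⟩
  b m ∎
  where
  cancel : ∀ a s → a - s + s ≡ a
  cancel = solve-∀

recX-cong : ∀ {b b' : ℕ → ℤ} → (∀ i → b i ≡ b' i) → ∀ m → recX b m ≡ recX b' m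
recX-cong {b} {b'} b≡b' = coefSum-injective λ m →
  trans (coefSum-recX b m) (trans (b≡b' m) (sym (coefSum-recX b' m)))

pos-^ : ∀ a i → + (a ℕ.^ i) ≡ (+ a) ℤ.^ i
pos-^ a zero    = refl
pos-^ a (suc i) = trans (ℤP.pos-* a (a ℕ.^ i)) (cong (+ a *_) (pos-^ a i))

^-as-ℤ^ : ∀ x m → x ℤ-Exp.^ m ≡ x ℤ.^ m
^-as-ℤ^ x zero    = refl
^-as-ℤ^ x (suc m) = cong (x *_) (^-as-ℤ^ x m)

×-as-* : ∀ n x → n ℤ-Mult.× x ≡ + n * x
×-as-* zero    x = sym (ℤP.*-zeroˡ x)
×-as-* (suc n) x = trans (cong (_+_ x) (×-as-* n x)) (sym (ℤP.suc-* (+ n) x))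

sum-as-Σ< : ∀ m (f : ℕ → ℤ) → ℤ-Sum.sum {m} (λ i → f (toℕ i)) ≡ Σ< m f
sum-as-Σ< zero    f = refl
sum-as-Σ< (suc m) f = trans (cong (_+_ (f 0)) (sum-as-Σ< m (λ j → f (suc j)))) (sym (Σ<-suc m f))

binomial : ∀ x y m → (x + y) ℤ.^ m ≡ Σ< (suc m) (λ j → + (m C j) * (x ℤ.^ j * y ℤ.^ (m ℕ.∸ j)))
binomial x y m = begin
  (x + y) ℤ.^ m
    ≡⟨ sym (^-as-ℤ^ (x + y) m) ⟩
  (x + y) ℤ-Exp.^ m
    ≡⟨ ℤ-Binomial.theorem m x y ⟩
  ℤ-Sum.sum (ℤ-Binomial.binomialTerm x y m)
    ≡⟨ sum-as-Σ< (suc m) _ ⟩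
  Σ< (suc m) (λ j → (m C j) ℤ-Mult.× (x ℤ-Exp.^ j * y ℤ-Exp.^ (m ℕ.∸ j)))
    ≡⟨ Σ<-cong (suc m) (λ {j} _ → trans (×-as-* (m C j) _)
         (cong (+ (m C j) *_) (cong₂ _*_ (^-as-ℤ^ x j) (^-as-ℤ^ y (m ℕ.∸ j))))) ⟩
  Σ< (suc m) (λ j → + (m C j) * (x ℤ.^ j * y ℤ.^ (m ℕ.∸ j))) ∎

binomial-shifts : ∀ x m →
  (x + + 2) ℤ.^ m + (x + + 1) ℤ.^ m ≡ Σ< m (λ j → coef m j * x ℤ.^ j) + + 2 * x ℤ.^ m
binomial-shifts x m = begin
  (x + + 2) ℤ.^ m + (x + + 1) ℤ.^ m
    ≡⟨ cong₂ _+_ (binomial x (+ 2) m) (binomial x (+ 1) m) ⟩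
  Σ< (suc m) (term (+ 2)) + Σ< (suc m) (term (+ 1))
    ≡⟨ sym (Σ<-+ (suc m) (term (+ 2)) (term (+ 1))) ⟩
  Σ< m (λ j → term (+ 2) j + term (+ 1) j) + (term (+ 2) m + term (+ 1) m)
    ≡⟨ cong₂ _+_ (Σ<-cong m (λ {j} _ → lower-terms j)) top-term ⟩
  Σ< m (λ j → coef m j * x ℤ.^ j) + + 2 * x ℤ.^ m ∎
  where
  term : ℤ → ℕ → ℤ
  term y j = + (m C j) * (x ℤ.^ j * y ℤ.^ (m ℕ.∸ j))

  lower-terms : ∀ j → term (+ 2) j + term (+ 1) j ≡ coef m j * x ℤ.^ j
  lower-terms j = trans
    (cong₂ (λ u v → + (m C j) * (x ℤ.^ j * u) + + (m C j) * (x ℤ.^ j * v))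
           (sym (pos-^ 2 (m ℕ.∸ j))) (ℤP.^-zeroˡ (m ℕ.∸ j)))
    (collect (+ (m C j)) (x ℤ.^ j) (+ (2 ℕ.^ (m ℕ.∸ j))))
    where
    collect : ∀ c a t → c * (a * t) + c * (a * + 1) ≡ c * (t + + 1) * a
    collect = solve-∀

  top-term : term (+ 2) m + term (+ 1) m ≡ + 2 * x ℤ.^ m
  top-term = trans
    (cong₂ (λ c k → + c * (x ℤ.^ m * (+ 2) ℤ.^ k) + + c * (x ℤ.^ m * (+ 1) ℤ.^ k)) (nCn≡1 m) (ℕP.n∸n≡0 m))
    (double (x ℤ.^ m))
    where
    double : ∀ a → + 1 * (a * + 1) + + 1 * (a * + 1) ≡ + 2 * a
    double = solve-∀

coefSum-powers : ∀ x m →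
  coefSum (λ j → + (x ℕ.^ j)) m ≡ + ((x ℕ.+ 2) ℕ.^ m) + + ((x ℕ.+ 1) ℕ.^ m) - + (x ℕ.^ m)
coefSum-powers x m = begin
  + (x ℕ.^ m) + Σ< m (λ j → coef m j * + (x ℕ.^ j))
    ≡⟨ cong₂ _+_ (pos-^ x m) (Σ<-cong m (λ {j} _ → cong (coef m j *_) (pos-^ x j))) ⟩
  (+ x) ℤ.^ m + Σ< m (λ j → coef m j * (+ x) ℤ.^ j)
    ≡⟨ rearrange ((+ x) ℤ.^ m) _ ⟩
  Σ< m (λ j → coef m j * (+ x) ℤ.^ j) + + 2 * (+ x) ℤ.^ m - (+ x) ℤ.^ m
    ≡⟨ cong (_- (+ x) ℤ.^ m) (sym (binomial-shifts (+ x) m)) ⟩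
  (+ x + + 2) ℤ.^ m + (+ x + + 1) ℤ.^ m - (+ x) ℤ.^ m
    ≡⟨ sym (cong₂ _-_ (cong₂ _+_ (pos-^ (x ℕ.+ 2) m) (pos-^ (x ℕ.+ 1) m)) (pos-^ x m)) ⟩
  + ((x ℕ.+ 2) ℕ.^ m) + + ((x ℕ.+ 1) ℕ.^ m) - + (x ℕ.^ m) ∎
  where
  rearrange : ∀ a s → a + s ≡ s + + 2 * a - a
  rearrange = solve-∀

P₂-suc : ∀ m n → P₂ m (suc n) ≡ P₁ m n
P₂-suc m n = recX-cong (λ i → cong (λ u → + (u ℕ.^ i)) (sym (ℕP.+-suc n 1))) m

power-as-P : ∀ m n → + (suc n ℕ.^ m) ≡ P₁ m (suc n) + P₁ m n - P₂ m n
power-as-P m n = coefSum-injective {λ j → + (suc n ℕ.^ j)} {λ j → P₁ j (suc n) + P₁ j n - P₂ j n} (λ k → begin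
  coefSum (λ j → + (suc n ℕ.^ j)) k
    ≡⟨ coefSum-powers (suc n) k ⟩
  + ((suc n ℕ.+ 2) ℕ.^ k) + + ((suc n ℕ.+ 1) ℕ.^ k) - + (suc n ℕ.^ k)
    ≡⟨ cong₂ (λ u v → + ((suc n ℕ.+ 2) ℕ.^ k) + + (u ℕ.^ k) - + (v ℕ.^ k))
             (sym (ℕP.+-suc n 1)) (ℕP.+-comm 1 n) ⟩
  + ((suc n ℕ.+ 2) ℕ.^ k) + + ((n ℕ.+ 2) ℕ.^ k) - + ((n ℕ.+ 1) ℕ.^ k)
    ≡⟨ sym (cong₂ _-_ (cong₂ _+_ (coefSum-recX (λ i → + ((suc n ℕ.+ 2) ℕ.^ i)) k)
                                 (coefSum-recX (λ i → + ((n ℕ.+ 2) ℕ.^ i)) k))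
                      (coefSum-recX (λ i → + ((n ℕ.+ 1) ℕ.^ i)) k)) ⟩
  coefSum (λ j → P₁ j (suc n)) k + coefSum (λ j → P₁ j n) k - coefSum (λ j → P₂ j n) k
    ≡⟨ sym (trans (coefSum-- (λ j → P₁ j (suc n) + P₁ j n) (λ j → P₂ j n) k)
                  (cong (_- coefSum (λ j → P₂ j n) k) (coefSum-+ (λ j → P₁ j (suc n)) (λ j → P₁ j n) k))) ⟩
  coefSum (λ j → P₁ j (suc n) + P₁ j n - P₂ j n) k ∎) m

constant-term : ∀ a c m → recX (λ i → - (+ (2 ℕ.^ i) * a) - c) m ≡ - (P₁ m 0 * a) - P₂ m 0 * c
constant-term a c = coefSum-injective (λ k → begin
  coefSum (recX (λ i → - (+ (2 ℕ.^ i) * a) - c)) k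
    ≡⟨ coefSum-recX (λ i → - (+ (2 ℕ.^ i) * a) - c) k ⟩
  - (+ (2 ℕ.^ k) * a) - c
    ≡⟨ cong (λ u → - (+ (2 ℕ.^ k) * a) - u) (sym (trans (cong (λ u → + u * c) (ℕP.^-zeroˡ k)) (ℤP.*-identityˡ c))) ⟩
  - (+ (2 ℕ.^ k) * a) - + (1 ℕ.^ k) * c
    ≡⟨ sym (cong₂ (λ u v → - (u * a) - v * c) (coefSum-recX (λ i → + (2 ℕ.^ i)) k)
                                              (coefSum-recX (λ i → + (1 ℕ.^ i)) k)) ⟩
  - (coefSum (λ j → P₁ j 0) k * a) - coefSum (λ j → P₂ j 0) k * c
    ≡⟨ sym (trans (coefSum-- (λ j → - (P₁ j 0 * a)) (λ j → P₂ j 0 * c) k)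
                  (cong₂ _-_ (trans (coefSum-neg (λ j → P₁ j 0 * a) k) (cong -_ (coefSum-*ʳ (λ j → P₁ j 0) a k)))
                             (coefSum-*ʳ (λ j → P₂ j 0) c k))) ⟩
  coefSum (λ j → - (P₁ j 0 * a) - P₂ j 0 * c) k ∎)

FibonacciLike : (ℤ → ℤ) → Set
FibonacciLike G = ∀ r → G (r + + 2) ≡ G (r + + 1) + G r

-- sgn (suc k) unfolds to - + 1 * sgn k, which is how the signs of F_{-k}, L_{-k} enter.
private
  negative-step : ∀ s a b → s * a ≡ (- + 1 * s) * b + (- + 1 * (- + 1 * s)) * (b + a)
  negative-step = solve-∀

F-fibonacciLike : FibonacciLike F
F-fibonacciLike (+ n)                 = trans (cong fibℕ (ℕP.+-comm n 2)) (cong (_+ fibℕ n) (cong fibℕ (ℕP.+-comm 1 n)))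
F-fibonacciLike -[1+ zero ]           = refl
F-fibonacciLike -[1+ suc zero ]       = refl
F-fibonacciLike -[1+ suc (suc n) ]    = negative-step (sgn n) (fibℕ (suc n)) (fibℕ (suc (suc n)))

L-fibonacciLike : FibonacciLike L
L-fibonacciLike (+ n)                 = trans (cong lucℕ (ℕP.+-comm n 2)) (cong (_+ lucℕ n) (cong lucℕ (ℕP.+-comm 1 n)))
L-fibonacciLike -[1+ zero ]           = refl
L-fibonacciLike -[1+ suc zero ]       = refl
L-fibonacciLike -[1+ suc (suc n) ]    = negative-step (sgn (suc n)) (lucℕ (suc n)) (lucℕ (suc (suc n)))

sum-formula : ∀ G → FibonacciLike G → ∀ m r n →
  Σ1 n (λ k → + (k ^ m) * G (+ k + r))
    ≡ P₁ m n * G (+ n + r) + P₂ m n * G (+ n + r + + 1) + recX (λ i → - (+ (2 ℕ.^ i) * G r) - G (r + + 1)) m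
sum-formula G G-rec m r zero = sym (begin
  P₁ m 0 * G (+ 0 + r) + P₂ m 0 * G (+ 0 + r + + 1) + C
    ≡⟨ cong (λ s → P₁ m 0 * G s + P₂ m 0 * G (s + + 1) + C) (ℤP.+-identityˡ r) ⟩
  P₁ m 0 * G r + P₂ m 0 * G (r + + 1) + C
    ≡⟨ cong (_+_ (P₁ m 0 * G r + P₂ m 0 * G (r + + 1))) (constant-term (G r) (G (r + + 1)) m) ⟩
  P₁ m 0 * G r + P₂ m 0 * G (r + + 1) + (- (P₁ m 0 * G r) - P₂ m 0 * G (r + + 1))
    ≡⟨ cancel (P₁ m 0 * G r) (P₂ m 0 * G (r + + 1)) ⟩
  + 0 ∎)
  where
  C : ℤ
  C = recX (λ i → - (+ (2 ℕ.^ i) * G r) - G (r + + 1)) m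
  cancel : ∀ a b → a + b + (- a - b) ≡ + 0
  cancel = solve-∀
sum-formula G G-rec m r (suc n) = begin
  Σ1 n (λ k → + (k ^ m) * G (+ k + r)) + + (suc n ^ m) * G (+ suc n + r)
    ≡⟨ cong₂ _+_ (sum-formula G G-rec m r n) (cong₂ _*_ (power-as-P m n) (cong G (shift (+ n) r))) ⟩
  P₁ m n * G₀ + P₂ m n * G₁ + C + (P₁ m (suc n) + P₁ m n - P₂ m n) * G₁
    ≡⟨ regroup (P₁ m (suc n)) (P₁ m n) (P₂ m n) G₀ G₁ C ⟩
  P₁ m (suc n) * G₁ + P₁ m n * (G₁ + G₀) + C
    ≡⟨ sym (cong₂ (λ s t → P₁ m (suc n) * G s + t + C) (shift (+ n) r)
                  (cong₂ _*_ (P₂-suc m n) (trans (cong G (shift₂ (+ n) r)) (G-rec (+ n + r))))) ⟩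
  P₁ m (suc n) * G (+ suc n + r) + P₂ m (suc n) * G (+ suc n + r + + 1) + C ∎
  where
  G₀ G₁ C : ℤ
  G₀ = G (+ n + r)
  G₁ = G (+ n + r + + 1)
  C = recX (λ i → - (+ (2 ℕ.^ i) * G r) - G (r + + 1)) m
  shift : ∀ a r → (+ 1 + a) + r ≡ a + r + + 1
  shift = solve-∀
  shift₂ : ∀ a r → (+ 1 + a) + r + + 1 ≡ a + r + + 2
  shift₂ = solve-∀
  regroup : ∀ p p' q g₀ g₁ c → p' * g₀ + q * g₁ + c + (p + p' - q) * g₁ ≡ p * g₁ + p' * (g₁ + g₀) + c
  regroup = solve-∀

mainTheorem3 : (m n : ℕ) (r : ℤ) →
    (Σ1 n (λ k → + (k ^ m) * F (+ k + r))
       ≡ P₁ m n * F (+ n + r) + P₂ m n * F (+ n + r + + 1) + Cc m r)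
    × (Σ1 n (λ k → + (k ^ m) * L (+ k + r))
       ≡ P₁ m n * L (+ n + r) + P₂ m n * L (+ n + r + + 1) + Kc m r)
mainTheorem3 m n r = sum-formula F F-fibonacciLike m r n , sum-formula L L-fibonacciLike m r n
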